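{- Let $0<k<n$ be integers. Then the van der Waerden complex ${\tt vdW}(n,k)$ is shellable if and only if $n\le 6$, or $n>6$ and $k=1$, or $n>6$ and $\frac{n}{2}\le k<n$.
   Context: Let $V=\{x_1,\ldots,x_n\}$ and $0<k<n$. The van der Waerden complex ${\tt vdW}(n,k)$ is the simplicial complex on $V$ whose facets are exactly the sets $\{x_i,x_{i+d},x_{i+2d},\ldots,x_{i+kd}\}$ for integers $d$ and $i$ with $1\le i<i+kd\le n$ (so $d\ge1$). A pure simplicial complex $\Delta$ is shellable if its facets can be ordered $F_1,\ldots,F_s$ such that for all $1\le i<j\le s$ there exist $x\in F_j\setminus F_i$ and $\ell\in\{1,\ldots,j-1\}$ with $F_j\setminus F_\ell=\{x\}$. -}

module Defs where

open import Data.Nat using (ℕ; _+_; _*_; _≤_; _<_)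
open import Data.Fin using (Fin; toℕ)
import Data.Fin as F
open import Data.Fin.Subset using (Subset; _∈_; _∉_; _─_; ⁅_⁆)
open import Data.Product using (Σ; ∃; _×_; Σ-syntax; ∃-syntax)
open import Function.Bundles using (_⇔_)
open import Function.Definitions using (Injective)
open import Relation.Binary.PropositionalEquality using (_≡_)

-- Vertex x_m (1 ≤ m ≤ n) is represented by the element (m - 1) : Fin n.
-- A face is a Subset n.

IsAPSet : (n k : ℕ) → (i d : ℕ) → Subset n → Set
IsAPSet n k i d S =
  (x : Fin n) → (x ∈ S) ⇔ (Σ[ j ∈ ℕ ] (j ≤ k × 1 + toℕ x ≡ i + j * d))

IsVdWFacet : (n k : ℕ) → Subset n → Set
IsVdWFacet n k S =
  Σ[ i ∈ ℕ ] Σ[ d ∈ ℕ ] (1 ≤ i × 1 ≤ d × i + k * d ≤ n × IsAPSet n k i d S)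

IsShelling : {n : ℕ} → (Subset n → Set) → (s : ℕ) → (Fin s → Subset n) → Set
IsShelling {n} IsFacet s Fs =
  Injective _≡_ _≡_ Fs
  × ((a : Fin s) → IsFacet (Fs a))
  × ((G : Subset n) → IsFacet G → ∃[ a ] Fs a ≡ G)
  × ((a b : Fin s) → a F.< b →
       Σ[ x ∈ Fin n ] (x ∈ Fs b × x ∉ Fs a
         × Σ[ l ∈ Fin s ] (l F.< b × (Fs b ─ Fs l) ≡ ⁅ x ⁆)))

Shellable : {n : ℕ} → (Subset n → Set) → Set
Shellable IsFacet = Σ[ s ∈ ℕ ] Σ[ Fs ∈ (Fin s → Subset _) ] IsShelling IsFacet s Fs

vdWShellable : (n k : ℕ) → Set
vdWShellable n k = Shellable (IsVdWFacet n k)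

-- The shellings are explicit. For k = 1 the facets are all edges of the complete graph, listed
-- colexicographically. For n ≤ 2k no progression with difference d ≥ 2 fits, so the facets are the
-- intervals of k + 1 consecutive vertices, listed from left to right. The two remaining small cases,
-- vdW(5,2) and vdW(6,2), are shelled by orders checked by evaluation.
--
-- Non-shellability comes from an invariant. Call facets G, H adjacent if G ∖ H is a single vertex.
-- In a shelling every facet is adjacent to an earlier one, so a property shared by adjacent facets
-- holds for all facets or for none. For k ≥ 3 the property is "contains two consecutive vertices":
-- such a facet is an interval, any adjacent facet keeps k ≥ 3 of its vertices and so a consecutive
-- pair, and a facet of difference ≥ 2 cannot share k vertices with an interval, since two of them
-- are at least 2(k - 1) > k apart. For k = 2 and n ≥ 7 the property is "the difference is a power
-- of two", because adjacent facets share two vertices, at distance d or 2d in each of them. The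
-- facets {1, 2, ..., k+1} and {1, 3, ..., 2k+1} (for k = 2: {1, 4, 7}) then disagree.

module Submission where

open import Defs
open import Data.Nat using (ℕ; _≤_; _<_; _*_)
open import Data.Sum using (_⊎_)
open import Data.Product using (_×_)
open import Function.Bundles using (_⇔_)
open import Relation.Binary.PropositionalEquality using (_≡_)

import Data.Bool.Properties as Bool
open import Data.Empty using (⊥-elim)
open import Data.Fin as Fin using (Fin; toℕ; fromℕ<)
import Data.Fin.Induction as Fin
import Data.Fin.Properties as Fin
open import Data.Fin.Subset using (Subset; _∈_; _∉_; _─_; ⁅_⁆; _⊆_; inside; outside)
open import Data.Fin.Subset.Properties
  using (_∈?_; ⊆-antisym; p─q⊆p; x∈⁅x⁆; x∈⁅y⁆⇒x≡y; x∈p∧x∉q⇒x∈p─q)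
open import Data.Nat
  using (zero; suc; pred; _+_; _∸_; _≰_; z≤n; s≤s; _≟_; _<?_; _≤?_; NonZero; >-nonZero)
open import Data.Nat.Divisibility using (_∣_; _∣?_; m∣m*n; ∣1⇒≡1)
open import Data.Nat.Properties
open import Data.Product using (_,_; proj₁; proj₂; uncurry; Σ-syntax; ∃-syntax)
open import Data.Sum using (inj₁; inj₂)
import Data.Sum
open import Data.Vec as Vec using (_∷_; []; here; there; tabulate)
open import Data.Vec.Properties as Vec using (lookup∘tabulate; []=⇒lookup; lookup⇒[]=)
open import Function.Base using (_∘_)
open import Function.Bundles using (Equivalence; mk⇔)
open import Function.Construct.Composition using (_⇔-∘_)
open import Function.Construct.Identity using (⇔-id)
open import Induction.WellFounded using (module All)
open import Relation.Binary.Definitions using (tri<; tri≈; tri>)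
open import Relation.Binary.PropositionalEquality
  using (_≢_; refl; sym; trans; cong; cong₂; subst; subst₂; module ≡-Reasoning)
open import Relation.Nullary using (¬_; Dec; yes; no; does; contradiction)
open import Relation.Nullary.Decidable
  using (map′; dec-true; from-no; True; toWitness; _×-dec_; _→-dec_; ¬?)
open import Relation.Unary using (Decidable)

open Equivalence using (to; from)

subsetOf : ∀ {n} {P : Fin n → Set} → Decidable P → Subset n
subsetOf P? = tabulate (λ x → does (P? x))

∈-subsetOf : ∀ {n} {P : Fin n → Set} (P? : Decidable P) x → x ∈ subsetOf P? ⇔ P x
∈-subsetOf P? x = mk⇔
  (λ x∈ → witness (P? x) (trans (sym (lookup∘tabulate _ x)) ([]=⇒lookup x∈)))
  (λ Px → lookup⇒[]= x (subsetOf P?) (trans (lookup∘tabulate _ x) (dec-true (P? x) Px)))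
  where
  witness : ∀ {A : Set} (a? : Dec A) → does a? ≡ inside → A
  witness (yes a) _ = a

x∈p─q⇒x∉q : ∀ {n} {x : Fin n} {p q : Subset n} → x ∈ p ─ q → x ∉ q
x∈p─q⇒x∉q {p = outside ∷ _} {inside ∷ _} () here
x∈p─q⇒x∉q {p = inside ∷ _} {inside ∷ _} () here
x∈p─q⇒x∉q {p = _ ∷ _} {_ ∷ _} (there x∈) (there x∈q) = x∈p─q⇒x∉q x∈ x∈q

module _ {n : ℕ} {G H : Subset n} {x : Fin n} where

  ─≡⁅⁆⇒∈∉ : G ─ H ≡ ⁅ x ⁆ → x ∈ G × x ∉ H
  ─≡⁅⁆⇒∈∉ G─H≡x = p─q⊆p G H x∈ , x∈p─q⇒x∉q x∈
    where x∈ = subst (x ∈_) (sym G─H≡x) (x∈⁅x⁆ x)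

  ─≡⁅⁆⇒∈ : G ─ H ≡ ⁅ x ⁆ → ∀ {y} → y ∈ G → y ≢ x → y ∈ H
  ─≡⁅⁆⇒∈ G─H≡x {y} y∈G y≢x with y ∈? H
  ... | yes y∈H = y∈H
  ... | no y∉H = contradiction (x∈⁅y⁆⇒x≡y x (subst (y ∈_) G─H≡x (x∈p∧x∉q⇒x∈p─q y∈G y∉H))) y≢x

  ∈∉⇒─≡⁅⁆ : x ∈ G → x ∉ H → (∀ {y} → y ∈ G → y ≢ x → y ∈ H) → G ─ H ≡ ⁅ x ⁆
  ∈∉⇒─≡⁅⁆ x∈G x∉H others = ⊆-antisym ⊆⁅x⁆ ⁅x⁆⊆
    where
    ⊆⁅x⁆ : G ─ H ⊆ ⁅ x ⁆
    ⊆⁅x⁆ {y} y∈ with y Fin.≟ x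
    ... | yes refl = x∈⁅x⁆ x
    ... | no y≢x = contradiction (others (p─q⊆p G H y∈) y≢x) (x∈p─q⇒x∉q y∈)
    ⁅x⁆⊆ : ⁅ x ⁆ ⊆ G ─ H
    ⁅x⁆⊆ y∈ with x∈⁅y⁆⇒x≡y x y∈
    ... | refl = x∈p∧x∉q⇒x∈p─q x∈G x∉H

ShellingStep : ∀ {n s} → (Fin s → Subset n) → Fin s → Fin s → Set
ShellingStep {n} {s} Fs a b =
  Σ[ x ∈ Fin n ] (x ∈ Fs b × x ∉ Fs a × Σ[ l ∈ Fin s ] (l Fin.< b × Fs b ─ Fs l ≡ ⁅ x ⁆))

module _ {n : ℕ} {IsFacet : Subset n → Set} (R : Subset n → Set)
  (R-adjacent : ∀ {G H x} → IsFacet G → IsFacet H → G ─ H ≡ ⁅ x ⁆ → R G ⇔ R H) where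

  -- The shelling condition for the pair (F₀, F_b) makes F_b adjacent to an earlier facet.
  shelling-invariant : ∀ {s Fs} → IsShelling IsFacet (suc s) Fs → ∀ b → R (Fs b) ⇔ R (Fs Fin.zero)
  shelling-invariant {Fs = Fs} (_ , facet , _ , shell) = All.wfRec Fin.<-wellFounded _ _ step
    where
    step : ∀ b → (∀ {l} → l Fin.< b → R (Fs l) ⇔ R (Fs Fin.zero)) → R (Fs b) ⇔ R (Fs Fin.zero)
    step Fin.zero _ = ⇔-id _
    step (Fin.suc b) ih with shell Fin.zero (Fin.suc b) (s≤s z≤n)
    ... | _ , _ , _ , l , l<b , adjacent = ih l<b ⇔-∘ R-adjacent (facet _) (facet l) adjacent

  invariant⇒¬shellable : ∀ {A B} → IsFacet A → R A → IsFacet B → ¬ R B → ¬ Shellable IsFacet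
  invariant⇒¬shellable A-facet _ _ _ (zero , _ , _ , _ , cover , _) with cover _ A-facet
  ... | () , _
  invariant⇒¬shellable A-facet RA B-facet ¬RB (suc s , Fs , shelling@(_ , _ , cover , _))
    with cover _ A-facet | cover _ B-facet
  ... | a , refl | b , refl =
    ¬RB (from (shelling-invariant shelling b) (to (shelling-invariant shelling a) RA))

OnProgression : (k i d m : ℕ) → Set
OnProgression k i d m = Σ[ j ∈ ℕ ] (j ≤ k × m ≡ i + j * d)

onProgression? : ∀ k i d m → Dec (OnProgression k i d m)
onProgression? k i d m =
  map′ (λ (j , j<1+k , m≡) → j , ≤-pred j<1+k , m≡) (λ (j , j≤k , m≡) → j , s≤s j≤k , m≡)
       (anyUpTo? (λ j → m ≟ i + j * d) (suc k))

progression : (n k i d : ℕ) → Subset n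
progression n k i d = subsetOf (λ x → onProgression? k i d (suc (toℕ x)))

progression-isAPSet : ∀ n k i d → IsAPSet n k i d (progression n k i d)
progression-isAPSet n k i d = ∈-subsetOf (λ x → onProgression? k i d (suc (toℕ x)))

IsAPSet-unique : ∀ {n k i d S T} → IsAPSet n k i d S → IsAPSet n k i d T → S ≡ T
IsAPSet-unique S-ap T-ap =
  ⊆-antisym (λ {x} x∈S → from (T-ap x) (to (S-ap x) x∈S))
            (λ {x} x∈T → from (S-ap x) (to (T-ap x) x∈T))

progression-facet : ∀ {n k i d} → 1 ≤ i → 1 ≤ d → i + k * d ≤ n →
                    IsVdWFacet n k (progression n k i d)
progression-facet {n} {k} {i} {d} 1≤i 1≤d bound =
  i , d , 1≤i , 1≤d , bound , progression-isAPSet n k i d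

+-*-split : ∀ a p q d → p ≤ q → a + q * d ≡ a + p * d + (q ∸ p) * d
+-*-split a p q d p≤q = begin
  a + q * d                  ≡⟨ cong (λ t → a + t * d) (m+[n∸m]≡n p≤q) ⟨
  a + (p + (q ∸ p)) * d      ≡⟨ cong (a +_) (*-distribʳ-+ d p (q ∸ p)) ⟩
  a + (p * d + (q ∸ p) * d)  ≡⟨ +-assoc a (p * d) _ ⟨
  a + p * d + (q ∸ p) * d    ∎
  where open ≡-Reasoning

progression-gap : ∀ {n k i d S} {y z : Fin n} → IsAPSet n k i d S → y ∈ S → z ∈ S → toℕ y < toℕ z →
                  Σ[ e ∈ ℕ ] (0 < e × e ≤ k × toℕ z ≡ toℕ y + e * d)
progression-gap {i = i} {d} {y = y} {z} S-ap y∈S z∈S y<z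
  with to (S-ap y) y∈S | to (S-ap z) z∈S
... | p , _ , y≡ | q , q≤k , z≡ with p <? q
... | yes p<q = q ∸ p , m<n⇒0<n∸m p<q , ≤-trans (m∸n≤m q p) q≤k , suc-injective (begin
      suc (toℕ z)                 ≡⟨ z≡ ⟩
      i + q * d                   ≡⟨ +-*-split i p q d (<⇒≤ p<q) ⟩
      i + p * d + (q ∸ p) * d     ≡⟨ cong (_+ (q ∸ p) * d) y≡ ⟨
      suc (toℕ y) + (q ∸ p) * d   ∎)
  where open ≡-Reasoning
... | no p≮q = contradiction (begin
      suc (toℕ z)   ≡⟨ z≡ ⟩
      i + q * d     ≤⟨ +-monoʳ-≤ i (*-monoˡ-≤ d (≮⇒≥ p≮q)) ⟩
      i + p * d     ≡⟨ y≡ ⟨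
      suc (toℕ y)   ∎) (<⇒≱ (s≤s y<z))
  where open ≤-Reasoning

module Terms (k a d : ℕ) {n : ℕ} (bound : suc a + k * d ≤ n) where

  term : ∀ j → j ≤ k → Fin n
  term j j≤k = fromℕ< {a + j * d} (≤-trans (s≤s (+-monoʳ-≤ a (*-monoˡ-≤ d j≤k))) bound)

  toℕ-term : ∀ j (j≤k : j ≤ k) → toℕ (term j j≤k) ≡ a + j * d
  toℕ-term j j≤k = Fin.toℕ-fromℕ< _

  term-∈ : ∀ {S} j (j≤k : j ≤ k) → IsAPSet n k (suc a) d S → term j j≤k ∈ S
  term-∈ j j≤k S-ap = from (S-ap (term j j≤k)) (j , j≤k , cong suc (toℕ-term j j≤k))

  term-≢ : ∀ j (j≤k : j ≤ k) {x : Fin n} j′ → 1 ≤ d → suc (toℕ x) ≡ suc a + j′ * d → j ≢ j′ →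
           term j j≤k ≢ x
  term-≢ j j≤k j′ 1≤d x≡ j≢j′ refl = j≢j′ (*-cancelʳ-≡ j j′ d {{>-nonZero 1≤d}}
    (+-cancelˡ-≡ a _ _ (trans (sym (toℕ-term j j≤k)) (suc-injective x≡))))

  consecutive-terms : d ≡ 1 → ∀ j (1+j≤k : suc j ≤ k) →
                      suc (toℕ (term j (<⇒≤ 1+j≤k))) ≡ toℕ (term (suc j) 1+j≤k)
  consecutive-terms refl j 1+j≤k = begin
    suc (toℕ (term j (<⇒≤ 1+j≤k)))   ≡⟨ cong suc (toℕ-term j (<⇒≤ 1+j≤k)) ⟩
    suc (a + j * 1)        ≡⟨ +-suc a (j * 1) ⟨
    a + suc j * 1          ≡⟨ toℕ-term (suc j) 1+j≤k ⟨
    toℕ (term (suc j) 1+j≤k)   ∎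
    where open ≡-Reasoning

  term-< : ∀ {j j′} (j≤k : j ≤ k) (j′≤k : j′ ≤ k) → 1 ≤ d → j < j′ →
           toℕ (term j j≤k) < toℕ (term j′ j′≤k)
  term-< {j} {j′} j≤k j′≤k 1≤d j<j′ = subst₂ _<_ (sym (toℕ-term j j≤k)) (sym (toℕ-term j′ j′≤k))
    (+-monoʳ-< a (*-monoˡ-< d {{>-nonZero 1≤d}} j<j′))

HasConsecutivePair : ∀ {n} → Subset n → Set
HasConsecutivePair {n} S = Σ[ y ∈ Fin n ] Σ[ z ∈ Fin n ] (suc (toℕ y) ≡ toℕ z × y ∈ S × z ∈ S)

consecutive⇒difference≡1 : ∀ {n k i d S} → IsAPSet n k i d S → HasConsecutivePair S → d ≡ 1
consecutive⇒difference≡1 {d = d} S-ap (y , z , z≡ , y∈S , z∈S)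
  with progression-gap S-ap y∈S z∈S (≤-reflexive z≡)
... | e , _ , _ , z≡′ = m*n≡1⇒n≡1 e d (+-cancelˡ-≡ (toℕ y) _ _ (begin
  toℕ y + e * d   ≡⟨ z≡′ ⟨
  toℕ z           ≡⟨ z≡ ⟨
  suc (toℕ y)     ≡⟨ +-comm 1 (toℕ y) ⟩
  toℕ y + 1       ∎))
  where open ≡-Reasoning

interval⇒consecutive : ∀ {n k a S} (bound : suc a + suc k * 1 ≤ n) →
                       IsAPSet n (suc k) (suc a) 1 S → HasConsecutivePair S
interval⇒consecutive {k = k} {a} bound S-ap =
  term 0 z≤n , term 1 (s≤s z≤n) , consecutive-terms refl 0 (s≤s z≤n) ,
  term-∈ 0 z≤n S-ap , term-∈ 1 (s≤s z≤n) S-ap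
  where open Terms (suc k) a 1 bound

pair-avoiding : ∀ K j₀ → Σ[ j ∈ ℕ ] (suc j ≤ 3 + K × j ≢ j₀ × suc j ≢ j₀)
pair-avoiding K 0 = 1 , s≤s (s≤s z≤n) , (λ ()) , (λ ())
pair-avoiding K 1 = 2 , s≤s (s≤s (s≤s z≤n)) , (λ ()) , (λ ())
pair-avoiding K (suc (suc j₀)) = 0 , s≤s z≤n , (λ ()) , (λ ())

spread-avoiding : ∀ K j₀ → j₀ ≤ 3 + K →
  Σ[ j₁ ∈ ℕ ] Σ[ j₂ ∈ ℕ ] (j₁ ≤ 3 + K × j₂ ≤ 3 + K × j₁ ≢ j₀ × j₂ ≢ j₀ × j₁ + (2 + K) ≤ j₂)
spread-avoiding K zero _ = 1 , 3 + K , s≤s z≤n , ≤-refl , (λ ()) , (λ ()) , ≤-refl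
spread-avoiding K (suc j₀) j₀≤k with suc j₀ ≟ 3 + K
... | yes refl = 0 , 2 + K , z≤n , n≤1+n _ , (λ ()) , (λ eq → 1+n≰n (≤-reflexive (sym eq))) , ≤-refl
... | no j₀≢k = 0 , 3 + K , z≤n , ≤-refl , (λ ()) , (λ k≡j₀ → j₀≢k (sym k≡j₀)) , n≤1+n _

[2+K]*2≰3+K : ∀ K → (2 + K) * 2 ≰ 3 + K
[2+K]*2≰3+K K (s≤s (s≤s (s≤s 1+K*2≤K))) = 1+n≰n (≤-trans 1+K*2≤K (m≤m*n K 2))

module _ {n K : ℕ} {G H : Subset n} {x : Fin n} where

  consecutive-adjacent-to : IsVdWFacet n (3 + K) G → G ─ H ≡ ⁅ x ⁆ →
                            HasConsecutivePair G → HasConsecutivePair H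
  consecutive-adjacent-to (zero , _ , () , _)
  consecutive-adjacent-to (suc a , d , _ , _ , bound , G-ap) G─H≡x G-pair
    with consecutive⇒difference≡1 G-ap G-pair | to (G-ap x) (proj₁ (─≡⁅⁆⇒∈∉ G─H≡x))
  ... | refl | j₀ , _ , x≡ with pair-avoiding K j₀
  ... | j , 1+j≤k , j≢j₀ , 1+j≢j₀ =
    term j j≤k , term (suc j) 1+j≤k , consecutive-terms refl j 1+j≤k ,
    ─≡⁅⁆⇒∈ G─H≡x (term-∈ j j≤k G-ap) (term-≢ j j≤k j₀ ≤-refl x≡ j≢j₀) ,
    ─≡⁅⁆⇒∈ G─H≡x (term-∈ (suc j) 1+j≤k G-ap) (term-≢ (suc j) 1+j≤k j₀ ≤-refl x≡ 1+j≢j₀)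
    where
    open Terms (3 + K) a 1 bound
    j≤k = <⇒≤ 1+j≤k

  consecutive-adjacent-from : IsVdWFacet n (3 + K) G → IsVdWFacet n (3 + K) H → G ─ H ≡ ⁅ x ⁆ →
                              HasConsecutivePair H → HasConsecutivePair G
  consecutive-adjacent-from (zero , _ , () , _) _ _ _
  consecutive-adjacent-from (suc a , zero , _ , () , _) _ _ _
  consecutive-adjacent-from (suc a , 1 , _ , _ , bound , G-ap) _ _ _ =
    interval⇒consecutive bound G-ap
  consecutive-adjacent-from (suc a , d@(suc (suc _)) , _ , 1≤d , bound , G-ap)
                            (_ , _ , _ , _ , _ , H-ap) G─H≡x H-pair
    with consecutive⇒difference≡1 H-ap H-pair | to (G-ap x) (proj₁ (─≡⁅⁆⇒∈∉ G─H≡x))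
  ... | refl | j₀ , j₀≤k , x≡ with spread-avoiding K j₀ j₀≤k
  ... | j₁ , j₂ , j₁≤k , j₂≤k , j₁≢j₀ , j₂≢j₀ , spread =
    short-gap (progression-gap H-ap t₁∈H t₂∈H t₁<t₂)
    where
    open Terms (3 + K) a d bound
    t₁ = term j₁ j₁≤k
    t₂ = term j₂ j₂≤k
    t₁∈H = ─≡⁅⁆⇒∈ G─H≡x (term-∈ j₁ j₁≤k G-ap) (term-≢ j₁ j₁≤k j₀ 1≤d x≡ j₁≢j₀)
    t₂∈H = ─≡⁅⁆⇒∈ G─H≡x (term-∈ j₂ j₂≤k G-ap) (term-≢ j₂ j₂≤k j₀ 1≤d x≡ j₂≢j₀)
    far : toℕ t₁ + (2 + K) * 2 ≤ toℕ t₂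
    far = begin
      toℕ t₁ + (2 + K) * 2        ≡⟨ cong (_+ (2 + K) * 2) (toℕ-term j₁ j₁≤k) ⟩
      a + j₁ * d + (2 + K) * 2    ≤⟨ +-monoʳ-≤ (a + j₁ * d) (*-monoʳ-≤ (2 + K) (s≤s (s≤s z≤n))) ⟩
      a + j₁ * d + (2 + K) * d    ≡⟨ +-assoc a (j₁ * d) _ ⟩
      a + (j₁ * d + (2 + K) * d)  ≡⟨ cong (a +_) (*-distribʳ-+ d j₁ (2 + K)) ⟨
      a + (j₁ + (2 + K)) * d      ≤⟨ +-monoʳ-≤ a (*-monoˡ-≤ d spread) ⟩
      a + j₂ * d                  ≡⟨ toℕ-term j₂ j₂≤k ⟨
      toℕ t₂                      ∎
      where open ≤-Reasoning
    t₁<t₂ : toℕ t₁ < toℕ t₂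
    t₁<t₂ = <-≤-trans (m<m+n (toℕ t₁) (s≤s z≤n)) far
    short-gap : Σ[ e ∈ ℕ ] (0 < e × e ≤ 3 + K × toℕ t₂ ≡ toℕ t₁ + e * 1) → HasConsecutivePair G
    short-gap (e , _ , e≤k , t₂≡) = contradiction (+-cancelˡ-≤ (toℕ t₁) _ _ (begin
      toℕ t₁ + (2 + K) * 2   ≤⟨ far ⟩
      toℕ t₂                 ≡⟨ t₂≡ ⟩
      toℕ t₁ + e * 1         ≤⟨ +-monoʳ-≤ (toℕ t₁) (≤-trans (≤-reflexive (*-identityʳ e)) e≤k) ⟩
      toℕ t₁ + (3 + K)       ∎)) ([2+K]*2≰3+K K)
      where open ≤-Reasoning

consecutive-adjacent : ∀ {n K G H x} → IsVdWFacet n (3 + K) G → IsVdWFacet n (3 + K) H →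
                       G ─ H ≡ ⁅ x ⁆ → HasConsecutivePair G ⇔ HasConsecutivePair H
consecutive-adjacent G-facet H-facet G─H≡x =
  mk⇔ (consecutive-adjacent-to G-facet G─H≡x) (consecutive-adjacent-from G-facet H-facet G─H≡x)

¬vdWShellable-k≥3 : ∀ n K → 1 + (3 + K) * 2 ≤ n → ¬ vdWShellable n (3 + K)
¬vdWShellable-k≥3 n K bound = invariant⇒¬shellable HasConsecutivePair consecutive-adjacent
  (progression-facet {i = 1} {d = 1} ≤-refl ≤-refl interval-bound)
  (interval⇒consecutive {k = 2 + K} interval-bound (progression-isAPSet n (3 + K) 1 1))
  (progression-facet {i = 1} {d = 2} ≤-refl (s≤s z≤n) bound)
  (λ pair → contradiction (consecutive⇒difference≡1 (progression-isAPSet n (3 + K) 1 2) pair) λ ())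
  where
  interval-bound : 1 + (3 + K) * 1 ≤ n
  interval-bound = ≤-trans (s≤s (*-monoʳ-≤ (3 + K) {1} {2} (s≤s z≤n))) bound

data PowerOf2 : ℕ → Set where
  one    : PowerOf2 1
  double : ∀ {m} → PowerOf2 m → PowerOf2 (2 * m)

PowerOf2-odd : ∀ {t} → PowerOf2 t → ¬ 2 ∣ t → t ≡ 1
PowerOf2-odd one _ = refl
PowerOf2-odd (double {m} _) 2∤2m = contradiction (m∣m*n {2} m) 2∤2m

¬PowerOf2-3 : ¬ PowerOf2 3
¬PowerOf2-3 p with PowerOf2-odd p (from-no (2 ∣? 3))
... | ()

PowerOf2-half : ∀ {m} → PowerOf2 (2 * m) → PowerOf2 m
PowerOf2-half p = halve p refl
  where
  halve : ∀ {t m} → PowerOf2 t → t ≡ 2 * m → PowerOf2 m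
  halve {m = m} one 1≡2m with ∣1⇒≡1 (subst (2 ∣_) (sym 1≡2m) (m∣m*n m))
  ... | ()
  halve (double p) 2m′≡2m = subst PowerOf2 (*-cancelˡ-≡ _ _ 2 2m′≡2m) p

PowerOf2-scale : ∀ {e d} → 0 < e → e ≤ 2 → PowerOf2 d ⇔ PowerOf2 (e * d)
PowerOf2-scale {1} {d} _ _ =
  mk⇔ (subst PowerOf2 (sym (*-identityˡ d))) (subst PowerOf2 (*-identityˡ d))
PowerOf2-scale {2} _ _ = mk⇔ double PowerOf2-half
PowerOf2-scale {suc (suc (suc _))} _ (s≤s (s≤s ()))

HasPowerOf2Difference : ∀ {n} → Subset n → Set
HasPowerOf2Difference {n} S = Σ[ i ∈ ℕ ] Σ[ d ∈ ℕ ] (IsAPSet n 2 i d S × PowerOf2 d)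

PowerOf2-difference-transfer : ∀ {n i d i′ d′ S T} {y z : Fin n} →
  IsAPSet n 2 i d S → IsAPSet n 2 i′ d′ T → toℕ y < toℕ z →
  y ∈ S → z ∈ S → y ∈ T → z ∈ T → PowerOf2 d → PowerOf2 d′
PowerOf2-difference-transfer {y = y} S-ap T-ap y<z y∈S z∈S y∈T z∈T p
  with progression-gap S-ap y∈S z∈S y<z | progression-gap T-ap y∈T z∈T y<z
... | e , 0<e , e≤2 , z≡ | e′ , 0<e′ , e′≤2 , z≡′ =
  from (PowerOf2-scale 0<e′ e′≤2) (subst PowerOf2 (+-cancelˡ-≡ (toℕ y) _ _ (trans (sym z≡) z≡′))
    (to (PowerOf2-scale 0<e e≤2) p))

two-avoiding : ∀ j₀ → Σ[ j₁ ∈ ℕ ] Σ[ j₂ ∈ ℕ ] (j₁ < j₂ × j₂ ≤ 2 × j₁ ≢ j₀ × j₂ ≢ j₀)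
two-avoiding 0 = 1 , 2 , ≤-refl , ≤-refl , (λ ()) , (λ ())
two-avoiding 1 = 0 , 2 , s≤s z≤n , ≤-refl , (λ ()) , (λ ())
two-avoiding (suc (suc _)) = 0 , 1 , s≤s z≤n , s≤s z≤n , (λ ()) , (λ ())

adjacent-shared-pair : ∀ {n K G H x} → IsVdWFacet n (2 + K) G → G ─ H ≡ ⁅ x ⁆ →
  Σ[ y ∈ Fin n ] Σ[ z ∈ Fin n ] (toℕ y < toℕ z × y ∈ G × z ∈ G × y ∈ H × z ∈ H)
adjacent-shared-pair (zero , _ , () , _) _
adjacent-shared-pair {K = K} {x = x} (suc a , d , _ , 1≤d , bound , G-ap) G─H≡x
  with to (G-ap x) (proj₁ (─≡⁅⁆⇒∈∉ G─H≡x))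
... | j₀ , _ , x≡ with two-avoiding j₀
... | j₁ , j₂ , j₁<j₂ , j₂≤2 , j₁≢j₀ , j₂≢j₀ =
  term j₁ j₁≤k , term j₂ j₂≤k , term-< j₁≤k j₂≤k 1≤d j₁<j₂ , y∈G , z∈G ,
  ─≡⁅⁆⇒∈ G─H≡x y∈G (term-≢ j₁ j₁≤k j₀ 1≤d x≡ j₁≢j₀) ,
  ─≡⁅⁆⇒∈ G─H≡x z∈G (term-≢ j₂ j₂≤k j₀ 1≤d x≡ j₂≢j₀)
  where
  open Terms (2 + K) a d bound
  j₂≤k = ≤-trans j₂≤2 (m≤m+n 2 K)
  j₁≤k = ≤-trans (<⇒≤ j₁<j₂) j₂≤k
  y∈G = term-∈ j₁ j₁≤k G-ap
  z∈G = term-∈ j₂ j₂≤k G-ap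

PowerOf2-difference-adjacent : ∀ {n G H x} → IsVdWFacet n 2 G → IsVdWFacet n 2 H →
  G ─ H ≡ ⁅ x ⁆ → HasPowerOf2Difference G ⇔ HasPowerOf2Difference H
PowerOf2-difference-adjacent G-facet@(i , d , _ , _ , _ , G-ap) (i′ , d′ , _ , _ , _ , H-ap) G─H≡x
  with adjacent-shared-pair {K = 0} G-facet G─H≡x
... | y , z , y<z , y∈G , z∈G , y∈H , z∈H = mk⇔
  (λ (_ , _ , G-ap′ , p) → i′ , d′ , H-ap , PowerOf2-difference-transfer G-ap′ H-ap y<z y∈G z∈G y∈H z∈H p)
  (λ (_ , _ , H-ap′ , p) → i , d , G-ap , PowerOf2-difference-transfer H-ap′ G-ap y<z y∈H z∈H y∈G z∈G p)

¬vdWShellable-k≡2 : ∀ n → 7 ≤ n → ¬ vdWShellable n 2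
¬vdWShellable-k≡2 n 7≤n = invariant⇒¬shellable HasPowerOf2Difference PowerOf2-difference-adjacent
  (progression-facet {i = 1} {d = 1} ≤-refl ≤-refl (≤-trans (s≤s (s≤s (s≤s z≤n))) 7≤n))
  (1 , 1 , progression-isAPSet n 2 1 1 , one)
  (progression-facet {i = 1} {d = 3} ≤-refl (s≤s z≤n) 7≤n)
  λ (_ , _ , B-ap , p) → ¬PowerOf2-3 (PowerOf2-difference-transfer B-ap B-ap′ y<z y∈B z∈B y∈B z∈B p)
  where
  open Terms 2 0 3 7≤n
  B-ap′ = progression-isAPSet n 2 1 3
  y<z = term-< z≤n (s≤s z≤n) (s≤s z≤n) (s≤s z≤n)
  y∈B = term-∈ 0 z≤n B-ap′
  z∈B = term-∈ 1 (s≤s z≤n) B-ap′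

onProgression-1⇔ : ∀ {k i m} → OnProgression k i 1 m ⇔ (i ≤ m × m ≤ i + k)
onProgression-1⇔ {k} {i} {m} = mk⇔
  (λ { (j , j≤k , refl) →
        m≤m+n i (j * 1) , +-monoʳ-≤ i (≤-trans (≤-reflexive (*-identityʳ j)) j≤k) })
  (λ (i≤m , m≤i+k) → m ∸ i , ≤-trans (∸-monoˡ-≤ i m≤i+k) (≤-reflexive (m+n∸m≡n i k)) ,
     trans (sym (m+[n∸m]≡n i≤m)) (cong (i +_) (sym (*-identityʳ (m ∸ i)))))

module IntervalShelling (n k : ℕ) (k<n : k < n) (n≤2k : n ≤ 2 * k) where

  s : ℕ
  s = n ∸ k

  interval : Fin s → Subset n
  interval a = progression n k (suc (toℕ a)) 1

  ∈-interval : ∀ {a y} → y ∈ interval a ⇔ (toℕ a ≤ toℕ y × toℕ y ≤ toℕ a + k)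
  ∈-interval {a} {y} = mk⇔
    (λ y∈ → let a≤y , y≤a+k = to onProgression-1⇔ (to (progression-isAPSet n k _ 1 y) y∈)
            in ≤-pred a≤y , ≤-pred y≤a+k)
    (λ (a≤y , y≤a+k) →
       from (progression-isAPSet n k _ 1 y) (from onProgression-1⇔ (s≤s a≤y , s≤s y≤a+k)))

  last-<n : ∀ (a : Fin s) → toℕ a + k < n
  last-<n a = ≤-trans (+-monoˡ-≤ k (Fin.toℕ<n a)) (≤-reflexive (m∸n+n≡m (<⇒≤ k<n)))

  first last : Fin s → Fin n
  first a = fromℕ< (≤-trans (s≤s (m≤m+n (toℕ a) k)) (last-<n a))
  last a = fromℕ< (last-<n a)

  first-∈ : ∀ a → first a ∈ interval a
  first-∈ a = from ∈-interval (≤-reflexive (sym (Fin.toℕ-fromℕ< _)) ,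
                               ≤-trans (≤-reflexive (Fin.toℕ-fromℕ< _)) (m≤m+n (toℕ a) k))

  last-∈ : ∀ a → last a ∈ interval a
  last-∈ a = from ∈-interval (≤-trans (m≤m+n (toℕ a) k) (≤-reflexive (sym (Fin.toℕ-fromℕ< _))) ,
                              ≤-reflexive (Fin.toℕ-fromℕ< _))

  last-∉ : ∀ {a b} → toℕ a < toℕ b → last b ∉ interval a
  last-∉ {b = b} a<b b+k∈ = <⇒≱ (+-monoˡ-< k a<b)
    (≤-trans (≤-reflexive (sym (Fin.toℕ-fromℕ< (last-<n b)))) (proj₂ (to ∈-interval b+k∈)))

  interval-injective : ∀ {a b} → interval a ≡ interval b → a ≡ b
  interval-injective eq = Fin.toℕ-injective (≤-antisym (start≤ (sym eq)) (start≤ eq))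
    where
    start≤ : ∀ {a b} → interval a ≡ interval b → toℕ b ≤ toℕ a
    start≤ {a} eq = ≤-trans (proj₁ (to ∈-interval (subst (first a ∈_) eq (first-∈ a))))
                            (≤-reflexive (Fin.toℕ-fromℕ< _))

  interval-facet : ∀ a → IsVdWFacet n k (interval a)
  interval-facet a = progression-facet (s≤s z≤n) ≤-refl
    (≤-trans (≤-reflexive (cong (suc (toℕ a) +_) (*-identityʳ k))) (last-<n a))

  interval-cover : ∀ G → IsVdWFacet n k G → ∃[ a ] interval a ≡ G
  interval-cover G (zero , _ , () , _)
  interval-cover G (suc a , zero , _ , () , _)
  interval-cover G (suc a , 1 , _ , _ , bound , G-ap) =
    fromℕ< a<s , trans (cong (λ t → progression n k (suc t) 1) (Fin.toℕ-fromℕ< a<s))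
                       (IsAPSet-unique (progression-isAPSet n k (suc a) 1) G-ap)
    where
    a<s : a < s
    a<s = m+n≤o⇒m≤o∸n (suc a) (≤-trans (≤-reflexive (cong (suc a +_) (sym (*-identityʳ k)))) bound)
  interval-cover G (suc a , suc (suc d) , _ , _ , bound , _) = contradiction (begin
    suc (2 * k)              ≡⟨ cong suc (*-comm 2 k) ⟩
    suc (k * 2)              ≤⟨ s≤s (*-monoʳ-≤ k (s≤s (s≤s z≤n))) ⟩
    suc (k * suc (suc d))    ≤⟨ s≤s (m≤n+m _ a) ⟩
    suc a + k * suc (suc d)  ≤⟨ bound ⟩
    n                        ≤⟨ n≤2k ⟩
    2 * k                    ∎) 1+n≰n
    where open ≤-Reasoning

  interval-shellingStep : ∀ {a b} → a Fin.< b → ShellingStep interval a b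
  interval-shellingStep {b = b} a<b =
    last b , last-∈ b , last-∉ a<b , l , l<b , ∈∉⇒─≡⁅⁆ (last-∈ b) (last-∉ l<b) others
    where
    instance _ = >-nonZero (≤-trans (s≤s z≤n) a<b)
    l<s : pred (toℕ b) < s
    l<s = ≤-trans (≤-reflexive (suc-pred (toℕ b))) (<⇒≤ (Fin.toℕ<n b))
    l = fromℕ< l<s
    1+l≡b : suc (toℕ l) ≡ toℕ b
    1+l≡b = trans (cong suc (Fin.toℕ-fromℕ< l<s)) (suc-pred (toℕ b))
    l<b : l Fin.< b
    l<b = ≤-reflexive 1+l≡b
    others : ∀ {y} → y ∈ interval b → y ≢ last b → y ∈ interval l
    others {y} y∈ y≢last with to ∈-interval y∈
    ... | b≤y , y≤b+k = from (∈-interval {l}) (l≤y , ≤-pred (begin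
      suc (toℕ y)      ≤⟨ ≤∧≢⇒< y≤b+k y≢b+k ⟩
      toℕ b + k        ≡⟨ cong (_+ k) 1+l≡b ⟨
      suc (toℕ l) + k  ∎))
      where
      open ≤-Reasoning
      l≤y = ≤-trans (n≤1+n (toℕ l)) (≤-trans (≤-reflexive 1+l≡b) b≤y)
      y≢b+k = λ y≡ → y≢last (Fin.toℕ-injective (trans y≡ (sym (Fin.toℕ-fromℕ< _))))

  shelling : vdWShellable n k
  shelling =
    s , interval , interval-injective , interval-facet , interval-cover , λ _ _ → interval-shellingStep

triangular : ℕ → ℕ
triangular zero = 0
triangular (suc m) = triangular m + m

triangular-mono-≤ : ∀ {m m′} → m ≤ m′ → triangular m ≤ triangular m′
triangular-mono-≤ {m′ = zero} z≤n = ≤-refl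
triangular-mono-≤ {m′ = suc m′} m≤1+m′ with m≤n⇒m<n∨m≡n m≤1+m′
... | inj₁ (s≤s m≤m′) = ≤-trans (triangular-mono-≤ m≤m′) (m≤m+n (triangular m′) m′)
... | inj₂ refl = ≤-refl

triangular-lex : ∀ {u v u′ v′} → u < v → v < v′ → triangular v + u < triangular v′ + u′
triangular-lex {v = v} {u′} u<v v<v′ =
  ≤-trans (+-monoʳ-< (triangular v) u<v) (≤-trans (triangular-mono-≤ v<v′) (m≤m+n _ u′))

triangular-unique : ∀ {u v u′ v′} → u < v → u′ < v′ →
                    triangular v + u ≡ triangular v′ + u′ → u ≡ u′ × v ≡ v′
triangular-unique {v = v} {v′ = v′} u<v u′<v′ eq with <-cmp v v′
... | tri< v<v′ _ _ = contradiction eq (<⇒≢ (triangular-lex u<v v<v′))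
... | tri> _ _ v′<v = contradiction (sym eq) (<⇒≢ (triangular-lex u′<v′ v′<v))
... | tri≈ _ refl _ = +-cancelˡ-≡ (triangular v) _ _ eq , refl

triangular-decode : ∀ n m → m < triangular n →
                    Σ[ u ∈ ℕ ] Σ[ v ∈ ℕ ] (u < v × v < n × m ≡ triangular v + u)
triangular-decode (suc n) m m<T with m <? triangular n
... | yes m<T′ = let u , v , u<v , v<n , m≡ = triangular-decode n m m<T′
                 in u , v , u<v , m≤n⇒m≤1+n v<n , m≡
... | no m≮T′ = m ∸ triangular n , n ,
                +-cancelˡ-< (triangular n) _ _ (subst (_< triangular n + n) m≡ m<T) , ≤-refl , m≡
  where
  m≡ : m ≡ triangular n + (m ∸ triangular n)
  m≡ = sym (m+[n∸m]≡n (≮⇒≥ m≮T′))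

HasEndpoints : ∀ {n} → Subset n → ℕ → ℕ → Set
HasEndpoints {n} S u v = ∀ y → y ∈ S ⇔ (toℕ y ≡ u ⊎ toℕ y ≡ v)

HasEndpoints-swap : ∀ {n} {S : Subset n} {u v} → HasEndpoints S u v → HasEndpoints S v u
HasEndpoints-swap S-ends y = mk⇔ (Data.Sum.swap ∘ to (S-ends y)) (from (S-ends y) ∘ Data.Sum.swap)

edge : ∀ n → ℕ → ℕ → Subset n
edge n u v = progression n 1 (suc u) (v ∸ u)

edge-endpoints : ∀ {n u v} → u ≤ v → HasEndpoints (edge n u v) u v
edge-endpoints {n} {u} {v} u≤v y = mk⇔
  (λ y∈ → case′ (to (progression-isAPSet n 1 (suc u) (v ∸ u) y) y∈))
  (λ { (inj₁ y≡u) → from (ap y) (0 , z≤n , cong suc (trans y≡u (sym (+-identityʳ u))))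
     ; (inj₂ y≡v) → from (ap y) (1 , s≤s z≤n , cong suc (trans y≡v (sym u+[v∸u]*1≡v))) })
  where
  ap = progression-isAPSet n 1 (suc u) (v ∸ u)
  u+[v∸u]*1≡v : u + 1 * (v ∸ u) ≡ v
  u+[v∸u]*1≡v = trans (cong (u +_) (*-identityˡ (v ∸ u))) (m+[n∸m]≡n u≤v)
  case′ : OnProgression 1 (suc u) (v ∸ u) (suc (toℕ y)) → toℕ y ≡ u ⊎ toℕ y ≡ v
  case′ (0 , _ , y≡) = inj₁ (trans (suc-injective y≡) (+-identityʳ u))
  case′ (1 , _ , y≡) = inj₂ (trans (suc-injective y≡) u+[v∸u]*1≡v)
  case′ (suc (suc _) , s≤s () , _)

endpoints-─≡⁅⁆ : ∀ {n S T t o p q} {x : Fin n} → HasEndpoints S t o → HasEndpoints T p q →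
  toℕ x ≡ t → o ≡ p ⊎ o ≡ q → t ≢ p → t ≢ q → S ─ T ≡ ⁅ x ⁆
endpoints-─≡⁅⁆ {x = x} S-ends T-ends x≡t o∈T t≢p t≢q =
  ∈∉⇒─≡⁅⁆ (from (S-ends x) (inj₁ x≡t)) x∉T others
  where
  x∉T : x ∉ _
  x∉T x∈T with to (T-ends x) x∈T
  ... | inj₁ x≡p = t≢p (trans (sym x≡t) x≡p)
  ... | inj₂ x≡q = t≢q (trans (sym x≡t) x≡q)
  others : ∀ {y} → y ∈ _ → y ≢ x → y ∈ _
  others {y} y∈S y≢x with to (S-ends y) y∈S
  ... | inj₁ y≡t = contradiction (Fin.toℕ-injective (trans y≡t (sym x≡t))) y≢x
  ... | inj₂ y≡o = from (T-ends y) (Data.Sum.map (trans y≡o) (trans y≡o) o∈T)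

-- The edge {0, w} precedes {u, v} and meets it exactly in u.
anchor : ∀ {u v} → u < v → 1 < v →
         Σ[ w ∈ ℕ ] (0 < w × w < v × (u ≡ 0 ⊎ u ≡ w) × triangular w + 0 < triangular v + u)
anchor {zero} _ 1<v = 1 , s≤s z≤n , 1<v , inj₁ refl , triangular-lex (s≤s z≤n) 1<v
anchor {suc u} u<v _ = suc u , s≤s z≤n , u<v , inj₂ refl , triangular-lex (s≤s z≤n) u<v

-- The edge {u, v}, u < v, gets index triangular v + u: edges are listed colexicographically.
module EdgeShelling (n : ℕ) where

  s : ℕ
  s = triangular n

  decode : (b : Fin s) → Σ[ u ∈ ℕ ] Σ[ v ∈ ℕ ] (u < v × v < n × toℕ b ≡ triangular v + u)
  decode b = triangular-decode n (toℕ b) (Fin.toℕ<n b)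

  U V : Fin s → ℕ
  U b = proj₁ (decode b)
  V b = proj₁ (proj₂ (decode b))

  U<V : ∀ b → U b < V b
  U<V b = proj₁ (proj₂ (proj₂ (decode b)))

  V<n : ∀ b → V b < n
  V<n b = proj₁ (proj₂ (proj₂ (proj₂ (decode b))))

  toℕ-decode : ∀ b → toℕ b ≡ triangular (V b) + U b
  toℕ-decode b = proj₂ (proj₂ (proj₂ (proj₂ (decode b))))

  edgeAt : Fin s → Subset n
  edgeAt b = edge n (U b) (V b)

  edgeAt-endpoints : ∀ b → HasEndpoints (edgeAt b) (U b) (V b)
  edgeAt-endpoints b = edge-endpoints (<⇒≤ (U<V b))

  index : ∀ {u v} → u < v → v < n → Fin s
  index {u} {v} u<v v<n = fromℕ< (≤-trans (+-monoʳ-< (triangular v) u<v) (triangular-mono-≤ v<n))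

  edgeAt-index : ∀ {u v} (u<v : u < v) (v<n : v < n) → edgeAt (index u<v v<n) ≡ edge n u v
  edgeAt-index u<v v<n = uncurry (cong₂ (edge n))
    (triangular-unique (U<V b) u<v (trans (sym (toℕ-decode b)) (Fin.toℕ-fromℕ< _)))
    where b = index u<v v<n

  low high : Fin s → Fin n
  low b = fromℕ< (<-trans (U<V b) (V<n b))
  high b = fromℕ< (V<n b)

  toℕ-low : ∀ b → toℕ (low b) ≡ U b
  toℕ-low b = Fin.toℕ-fromℕ< _

  toℕ-high : ∀ b → toℕ (high b) ≡ V b
  toℕ-high b = Fin.toℕ-fromℕ< _

  low≢high : ∀ b → toℕ (low b) ≢ toℕ (high b)
  low≢high b eq = <⇒≢ (U<V b) (trans (sym (toℕ-low b)) (trans eq (toℕ-high b)))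

  low-∈ : ∀ b → low b ∈ edgeAt b
  low-∈ b = from (edgeAt-endpoints b (low b)) (inj₁ (toℕ-low b))

  high-∈ : ∀ b → high b ∈ edgeAt b
  high-∈ b = from (edgeAt-endpoints b (high b)) (inj₂ (toℕ-high b))

  edgeAt-injective : ∀ {a b} → edgeAt a ≡ edgeAt b → a ≡ b
  edgeAt-injective {a} {b} eq with endpoint-of-b (low-∈ a) | endpoint-of-b (high-∈ a)
    where
    endpoint-of-b : ∀ {y} → y ∈ edgeAt a → toℕ y ≡ U b ⊎ toℕ y ≡ V b
    endpoint-of-b {y} y∈ = to (edgeAt-endpoints b y) (subst (y ∈_) eq y∈)
  ... | inj₁ Ua≡Ub | inj₂ Va≡Vb = Fin.toℕ-injective (begin
    toℕ a                    ≡⟨ toℕ-decode a ⟩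
    triangular (V a) + U a   ≡⟨ cong₂ (λ u v → triangular v + u) (trans (sym (toℕ-low a)) Ua≡Ub)
                                                                (trans (sym (toℕ-high a)) Va≡Vb) ⟩
    triangular (V b) + U b   ≡⟨ toℕ-decode b ⟨
    toℕ b                    ∎)
    where open ≡-Reasoning
  ... | inj₁ Ua≡Ub | inj₁ Va≡Ub = contradiction (trans Ua≡Ub (sym Va≡Ub)) (low≢high a)
  ... | inj₂ Ua≡Vb | inj₂ Va≡Vb = contradiction (trans Ua≡Vb (sym Va≡Vb)) (low≢high a)
  ... | inj₂ Ua≡Vb | inj₁ Va≡Ub = ⊥-elim (<-asym (U<V a) (subst₂ _<_
    (trans (sym Va≡Ub) (toℕ-high a)) (trans (sym Ua≡Vb) (toℕ-low a)) (U<V b)))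

  edgeAt-facet : ∀ b → IsVdWFacet n 1 (edgeAt b)
  edgeAt-facet b = progression-facet (s≤s z≤n) (m<n⇒0<n∸m (U<V b)) (begin
    suc (U b + 1 * (V b ∸ U b))  ≡⟨ cong (λ t → suc (U b + t)) (*-identityˡ _) ⟩
    suc (U b + (V b ∸ U b))      ≡⟨ cong suc (m+[n∸m]≡n (<⇒≤ (U<V b))) ⟩
    suc (V b)                    ≤⟨ V<n b ⟩
    n                            ∎)
    where open ≤-Reasoning

  edgeAt-cover : ∀ G → IsVdWFacet n 1 G → ∃[ b ] edgeAt b ≡ G
  edgeAt-cover G (zero , _ , () , _)
  edgeAt-cover G (suc u , d , _ , 1≤d , bound , G-ap) = index u<v v<n , (begin
    edgeAt (index u<v v<n)                 ≡⟨ edgeAt-index u<v v<n ⟩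
    progression n 1 (suc u) (u + d ∸ u)    ≡⟨ cong (progression n 1 (suc u)) (m+n∸m≡n u d) ⟩
    progression n 1 (suc u) d              ≡⟨ IsAPSet-unique (progression-isAPSet n 1 (suc u) d) G-ap ⟩
    G                                      ∎)
    where
    open ≡-Reasoning
    u<v : u < u + d
    u<v = ≤-trans (≤-reflexive (+-comm 1 u)) (+-monoʳ-≤ u 1≤d)
    v<n : u + d < n
    v<n = ≤-trans (≤-reflexive (cong (λ t → suc (u + t)) (sym (+-identityʳ d)))) bound

  earlier-edge : ∀ b {t o w} {x : Fin n} → toℕ x ≡ t → HasEndpoints (edgeAt b) t o →
                 (0<w : 0 < w) (w<n : w < n) → o ≡ 0 ⊎ o ≡ w → t ≢ 0 → t ≢ w →
                 triangular w + 0 < toℕ b → Σ[ l ∈ Fin s ] (l Fin.< b × edgeAt b ─ edgeAt l ≡ ⁅ x ⁆)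
  earlier-edge b x≡t b-ends 0<w w<n o∈ t≢0 t≢w w<b =
    index 0<w w<n , ≤-trans (s≤s (≤-reflexive (Fin.toℕ-fromℕ< _))) w<b ,
    endpoints-─≡⁅⁆ b-ends l-ends x≡t o∈ t≢0 t≢w
    where
    l-ends = subst (λ S → HasEndpoints S 0 _) (sym (edgeAt-index 0<w w<n)) (edge-endpoints z≤n)

  edgeAt-∉ : ∀ {a t} {y : Fin n} → toℕ y ≡ t → t ≢ U a → t ≢ V a → y ∉ edgeAt a
  edgeAt-∉ {a} {y = y} y≡t t≢U t≢V y∈ with to (edgeAt-endpoints a y) y∈
  ... | inj₁ y≡U = t≢U (trans (sym y≡t) y≡U)
  ... | inj₂ y≡V = t≢V (trans (sym y≡t) y≡V)

  V-mono : ∀ {a b} → a Fin.< b → V a ≤ V b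
  V-mono {a} {b} a<b = ≮⇒≥ λ Vb<Va →
    <-asym a<b (subst₂ _<_ (sym (toℕ-decode b)) (sym (toℕ-decode a)) (triangular-lex (U<V b) Vb<Va))

  U-mono : ∀ {a b} → a Fin.< b → V a ≡ V b → U a < U b
  U-mono {a} {b} a<b Va≡Vb = +-cancelˡ-< (triangular (V b)) _ _
    (subst₂ _<_ (trans (toℕ-decode a) (cong (λ v → triangular v + U a) Va≡Vb)) (toℕ-decode b) a<b)

  step-same-top : ∀ {a b} → a Fin.< b → V a ≡ V b → ShellingStep edgeAt a b
  step-same-top {a} {b} a<b Va≡Vb = low b , low-∈ b ,
    edgeAt-∉ (toℕ-low b) (>⇒≢ Ua<Ub) (λ Ub≡Va → <⇒≢ (U<V b) (trans Ub≡Va Va≡Vb)) ,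
    earlier-edge b (toℕ-low b) (edgeAt-endpoints b) (≤-trans (s≤s z≤n) (U<V b)) (V<n b) (inj₂ refl)
      (>⇒≢ 0<Ub) (<⇒≢ (U<V b))
      (≤-trans (+-monoʳ-< (triangular (V b)) 0<Ub) (≤-reflexive (sym (toℕ-decode b))))
    where
    Ua<Ub = U-mono a<b Va≡Vb
    0<Ub = ≤-trans (s≤s z≤n) Ua<Ub

  step-new-top : ∀ {a b} → a Fin.< b → V a < V b → ShellingStep edgeAt a b
  step-new-top {a} {b} a<b Va<Vb
    with anchor (U<V b) (<-≤-trans (s≤s (≤-trans (s≤s z≤n) (U<V a))) Va<Vb)
  ... | w , 0<w , w<Vb , Ub∈ , w<b = high b , high-∈ b ,
    edgeAt-∉ (toℕ-high b) (>⇒≢ (<-trans (U<V a) Va<Vb)) (>⇒≢ Va<Vb) ,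
    earlier-edge b (toℕ-high b) (HasEndpoints-swap (edgeAt-endpoints b)) 0<w (<-trans w<Vb (V<n b)) Ub∈
      (>⇒≢ (≤-trans (s≤s z≤n) (U<V b))) (>⇒≢ w<Vb) (≤-trans w<b (≤-reflexive (sym (toℕ-decode b))))

  edgeAt-shellingStep : ∀ a b → a Fin.< b → ShellingStep edgeAt a b
  edgeAt-shellingStep a b a<b with V a ≟ V b
  ... | yes Va≡Vb = step-same-top a<b Va≡Vb
  ... | no Va≢Vb = step-new-top a<b (≤∧≢⇒< (V-mono a<b) Va≢Vb)

  shelling : vdWShellable n 1
  shelling = s , edgeAt , edgeAt-injective , edgeAt-facet , edgeAt-cover , edgeAt-shellingStep

-- params a = (i, d) describes the a-th facet; the shelling conditions are then checked by evaluation.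
module CheckedShelling (n k : ℕ) .{{_ : NonZero k}} (s : ℕ) (params : Fin s → ℕ × ℕ) where

  facets : Fin s → Subset n
  facets a = progression n k (proj₁ (params a)) (proj₂ (params a))

  ValidParams : ℕ → ℕ → Set
  ValidParams i d = 1 ≤ i × 1 ≤ d × i + k * d ≤ n

  validParams? : ∀ i d → Dec (ValidParams i d)
  validParams? i d = (1 ≤? i) ×-dec (1 ≤? d) ×-dec (i + k * d ≤? n)

  _≟ₛ_ : (p q : Subset n) → Dec (p ≡ q)
  _≟ₛ_ = Vec.≡-dec Bool._≟_

  valid? : Dec (∀ a → ValidParams (proj₁ (params a)) (proj₂ (params a)))
  valid? = Fin.all? λ a → validParams? (proj₁ (params a)) (proj₂ (params a))

  injective? : Dec (∀ a b → facets a ≡ facets b → a ≡ b)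
  injective? = Fin.all? λ a → Fin.all? λ b → (facets a ≟ₛ facets b) →-dec (a Fin.≟ b)

  steps? : Dec (∀ a b → a Fin.< b → ShellingStep facets a b)
  steps? = Fin.all? λ a → Fin.all? λ b → (a Fin.<? b) →-dec
    Fin.any? λ x → (x ∈? facets b) ×-dec ¬? (x ∈? facets a) ×-dec
      Fin.any? λ l → (l Fin.<? b) ×-dec ((facets b ─ facets l) ≟ₛ ⁅ x ⁆)

  covering? : Dec (∀ (i d : Fin (suc n)) → ValidParams (toℕ i) (toℕ d) →
                   ∃[ a ] facets a ≡ progression n k (toℕ i) (toℕ d))
  covering? = Fin.all? λ i → Fin.all? λ d → validParams? (toℕ i) (toℕ d) →-dec
    Fin.any? λ a → facets a ≟ₛ progression n k (toℕ i) (toℕ d)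

  shelling : True valid? → True injective? → True steps? → True covering? → vdWShellable n k
  shelling valid injective steps covering =
    s , facets , (λ {a} {b} → toWitness injective a b) , facet , cover , toWitness steps
    where
    facet : ∀ a → IsVdWFacet n k (facets a)
    facet a = let 1≤i , 1≤d , bound = toWitness valid a in progression-facet 1≤i 1≤d bound
    cover : ∀ G → IsVdWFacet n k G → ∃[ a ] facets a ≡ G
    cover G (i , d , 1≤i , 1≤d , bound , G-ap) =
      let a , eq = toWitness covering (fromℕ< i<1+n) (fromℕ< d<1+n)
                     (subst₂ ValidParams (sym toℕ-i) (sym toℕ-d) (1≤i , 1≤d , bound))
      in a , trans eq (trans (cong₂ (progression n k) toℕ-i toℕ-d)
                             (IsAPSet-unique (progression-isAPSet n k i d) G-ap))
      where
      i<1+n : i < suc n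
      i<1+n = s≤s (m+n≤o⇒m≤o i bound)
      d<1+n : d < suc n
      d<1+n = s≤s (≤-trans (m≤n*m d k) (m+n≤o⇒n≤o i bound))
      toℕ-i = Fin.toℕ-fromℕ< i<1+n
      toℕ-d = Fin.toℕ-fromℕ< d<1+n

vdWShellable-5-2 : vdWShellable 5 2
vdWShellable-5-2 = CheckedShelling.shelling 5 2 4 params _ _ _ _
  where
  params : Fin 4 → ℕ × ℕ
  params = Vec.lookup ((1 , 1) ∷ (2 , 1) ∷ (3 , 1) ∷ (1 , 2) ∷ [])

vdWShellable-6-2 : vdWShellable 6 2
vdWShellable-6-2 = CheckedShelling.shelling 6 2 6 params _ _ _ _
  where
  params : Fin 6 → ℕ × ℕ
  params = Vec.lookup ((1 , 1) ∷ (2 , 1) ∷ (3 , 1) ∷ (4 , 1) ∷ (1 , 2) ∷ (2 , 2) ∷ [])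

sparse-small-cases : ∀ {n k} → 1 < k → 2 * k < n → n ≤ 6 → (n ≡ 5 ⊎ n ≡ 6) × k ≡ 2
sparse-small-cases {k = 1} (s≤s ()) _ _
sparse-small-cases {k = 2} _ 4<n n≤6 with m≤n⇒m<n∨m≡n 4<n
... | inj₂ 5≡n = inj₁ (sym 5≡n) , refl
... | inj₁ 5<n = inj₂ (≤-antisym n≤6 5<n) , refl
sparse-small-cases {k = suc (suc (suc k))} _ 2k<n n≤6 =
  contradiction (≤-<-trans (*-monoʳ-≤ 2 {3} (s≤s (s≤s (s≤s z≤n)))) (<-≤-trans 2k<n n≤6)) (<-irrefl refl)

vdWShellable-small : ∀ n k → 0 < k → k < n → n ≤ 6 → vdWShellable n k
vdWShellable-small n k 0<k k<n n≤6 with k ≟ 1 | n ≤? 2 * k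
... | yes refl | _ = EdgeShelling.shelling n
... | no _ | yes n≤2k = IntervalShelling.shelling n k k<n n≤2k
... | no k≢1 | no n≰2k with sparse-small-cases (≤∧≢⇒< 0<k (k≢1 ∘ sym)) (≰⇒> n≰2k) n≤6
...   | inj₁ refl , refl = vdWShellable-5-2
...   | inj₂ refl , refl = vdWShellable-6-2

¬vdWShellable-sparse : ∀ n k → 1 < k → 6 < n → 2 * k < n → ¬ vdWShellable n k
¬vdWShellable-sparse n 1 (s≤s ()) _ _
¬vdWShellable-sparse n 2 _ 6<n _ = ¬vdWShellable-k≡2 n 6<n
¬vdWShellable-sparse n (suc (suc (suc K))) _ _ 2k<n =
  ¬vdWShellable-k≥3 n K (subst (_< n) (*-comm 2 (3 + K)) 2k<n)

corollary1p2 : (n k : ℕ) → 0 < k → k < n →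
    vdWShellable n k ⇔ (n ≤ 6 ⊎ (6 < n × k ≡ 1) ⊎ (6 < n × n ≤ 2 * k × k < n))
corollary1p2 n k 0<k k<n = mk⇔ classify construct
  where
  construct : n ≤ 6 ⊎ (6 < n × k ≡ 1) ⊎ (6 < n × n ≤ 2 * k × k < n) → vdWShellable n k
  construct (inj₁ n≤6) = vdWShellable-small n k 0<k k<n n≤6
  construct (inj₂ (inj₁ (_ , refl))) = EdgeShelling.shelling n
  construct (inj₂ (inj₂ (_ , n≤2k , _))) = IntervalShelling.shelling n k k<n n≤2k
  classify : vdWShellable n k → n ≤ 6 ⊎ (6 < n × k ≡ 1) ⊎ (6 < n × n ≤ 2 * k × k < n)
  classify shellable with n ≤? 6 | k ≟ 1 | n ≤? 2 * k
  ... | yes n≤6 | _ | _ = inj₁ n≤6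
  ... | no n≰6 | yes k≡1 | _ = inj₂ (inj₁ (≰⇒> n≰6 , k≡1))
  ... | no n≰6 | no _ | yes n≤2k = inj₂ (inj₂ (≰⇒> n≰6 , n≤2k , k<n))
  ... | no n≰6 | no k≢1 | no n≰2k =
    contradiction shellable (¬vdWShellable-sparse n k (≤∧≢⇒< 0<k (k≢1 ∘ sym)) (≰⇒> n≰6) (≰⇒> n≰2k))
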